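{- Let $q\ge2$ and $n\ge1$ be integers. Under each of the scenarios $(*\circ)$, $(\circ *)$, $(**)$, and $(\bullet *)$, the set $\mathcal{F}_q$ of all functions $[q\rangle\to\{0,1\}$ is $n$-cell implementable if and only if $q\le n$.
   Context: $[b\rangle=\{0,1,\ldots,b-1\}$. Let $\mathbb{B}=\{0,1\}$, $\mathbb{B}_\circ=\mathbb{B}$, $\mathbb{B}_*=\mathbb{B}\cup\{*\}$, $\mathbb{B}_\bullet=\mathbb{B}\cup\{*,\bullet\}$. Define $\mathrm{T}:\mathbb{B}_\bullet^2\to\mathbb{B}$ by $\mathrm{T}(u,\vartheta)=1$ if and only if $u=*$, or $\vartheta=*$, or $u=\vartheta\in\mathbb{B}$. $\mathcal{F}_q$ is the set of all functions $[q\rangle\to\mathbb{B}$. For $\alpha,\beta\in\{\circ,*,\bullet\}$, a subset $\Phi\subseteq\mathcal{F}_q$ is $n$-cell implementable under scenario $(\alpha\beta)$ if there exist mappings $\mathbf{u}=(u_j)_{j\in[n\rangle}:[q\rangle\to\mathbb{B}_\alpha^n$ and $\boldsymbol{\vartheta}=(\vartheta_j)_{j\in[n\rangle}:\Phi\to\mathbb{B}_\beta^n$ such that $f(x)=\bigwedge_{j\in[n\rangle}\mathrm{T}(u_j(x),\vartheta_j(f))$ for all $f\in\Phi$ and $x\in[q\rangle$. -}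

module Defs where

open import Data.Bool using (Bool; true; false; _∧_)
open import Data.Fin using (Fin)
open import Data.Nat using (ℕ)
open import Data.Unit using (⊤)
open import Data.Empty using (⊥)
open import Data.Product using (Σ; ∃; _×_)
open import Relation.Binary.PropositionalEquality using (_≡_)

data B• : Set where
  b0 b1 star bullet : B•

data Sym : Set where
  circ ast dot : Sym

InAlph : Sym → B• → Set
InAlph circ b0 = ⊤
InAlph circ b1 = ⊤
InAlph circ _ = ⊥
InAlph ast bullet = ⊥
InAlph ast _ = ⊤
InAlph dot _ = ⊤

Alph : Sym → Set
Alph α = Σ B• (InAlph α)

T : B• → B• → Bool
T star _ = true
T _ star = true
T b0 b0 = true
T b1 b1 = true
T _ _ = false

⋀ : (n : ℕ) → (Fin n → Bool) → Bool
⋀ ℕ.zero g = true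
⋀ (ℕ.suc n) g = g Fin.zero ∧ ⋀ n (λ j → g (Fin.suc j))

ℱ : ℕ → Set
ℱ q = Fin q → Bool

Implementable : (α β : Sym) (q n : ℕ) (Φ : ℱ q → Set) → Set
Implementable α β q n Φ =
  Σ (Fin q → Fin n → Alph α) λ u →
  Σ ((f : ℱ q) → Φ f → Fin n → Alph β) λ ϑ →
  (f : ℱ q) (φ : Φ f) (x : Fin q) →
    f x ≡ ⋀ n (λ j → T (Σ.proj₁ (u x j)) (Σ.proj₁ (ϑ f φ j)))

Allℱ : (q : ℕ) → ℱ q → Set
Allℱ q f = ⊤

-- If q ≤ n, point x gets its own cell, where it carries 1 while every other point carries a symbol
-- that ϑ never rejects, and ϑ on that cell encodes f(x).
-- Conversely, as long as ϑ avoids •, cell j at setting ϑ_j ∈ {0,1} rejects the points x with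
-- T(u_j(x), ϑ_j) = 0 and ϑ_j = * rejects nothing, so the zero set of every f is a union of
-- sets chosen one per cell.  In particular each point is rejected alone by some cell.  If q > n,
-- two points x ≠ y are isolated by the same cell j, necessarily at its two settings; then j rejects
-- nothing outside {x, y} and never both at once, so deleting j and merging y into x leaves a system
-- with the same property on q − 1 points and n − 1 cells, and induction gives q ≤ n.
module Submission where

open import Defs
open import Data.Nat using (ℕ; _≤_)
open import Data.Sum using (_⊎_)
open import Data.Product using (_×_)
open import Relation.Binary.PropositionalEquality using (_≡_)
open import Function.Bundles using (_⇔_)

open import Data.Bool using (Bool; true; false; _∧_; not; if_then_else_)
open import Data.Bool.Properties using (∧-zeroʳ; ∧-identityʳ; ¬-not)
import Data.Bool.Properties as Bool
open import Data.Empty using (⊥)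
open import Data.Fin using (Fin; zero; suc; punchIn; punchOut; inject≤; _≟_)
open import Data.Fin.Properties
  using (any?; pigeonhole; <⇒≢; suc-injective; inject≤-injective;
         punchIn-injective; punchInᵢ≢i; punchIn-punchOut; punchOut-cong; punchOut-punchIn)
open import Data.Maybe using (Maybe; just; nothing)
open import Data.Maybe.Properties using (just-injective)
open import Data.Nat using (zero; suc; _<_; z≤n; s≤s)
open import Data.Nat.Properties using (≮⇒≥; <⇒≱)
open import Data.Product using (∃-syntax; _,_; proj₁; proj₂)
open import Data.Sum using (inj₁; inj₂)
open import Data.Unit using (tt)
open import Function using (_∘_)
open import Function.Bundles using (Equivalence; mk⇔)
open import Function.Definitions using (Injective)
open import Relation.Nullary using (yes; no; does; contradiction)
open import Relation.Nullary.Decidable using (dec-true; dec-false)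
open import Relation.Binary.PropositionalEquality using (_≢_; refl; sym; trans; cong; subst)

open Equivalence

⋀-true : ∀ n {g : Fin n → Bool} → (∀ j → g j ≡ true) → ⋀ n g ≡ true
⋀-true zero    all = refl
⋀-true (suc n) all rewrite all zero = ⋀-true n (all ∘ suc)

⋀-single : ∀ n {g : Fin n → Bool} k → (∀ j → j ≢ k → g j ≡ true) → ⋀ n g ≡ g k
⋀-single (suc n) {g} zero others
  rewrite ⋀-true n (λ j → others (suc j) λ ()) = ∧-identityʳ (g zero)
⋀-single (suc n) (suc k) others
  rewrite others zero (λ ()) = ⋀-single n k (λ j j≢k → others (suc j) (j≢k ∘ suc-injective))

⋀-false⇒ : ∀ n {g : Fin n → Bool} → ⋀ n g ≡ false → ∃[ j ] g j ≡ false
⋀-false⇒ (suc n) {g} ⋀≡false with g zero in eq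
... | false = zero , eq
... | true  = let j , e = ⋀-false⇒ n ⋀≡false in suc j , e

⋀-false⇐ : ∀ n {g : Fin n → Bool} j → g j ≡ false → ⋀ n g ≡ false
⋀-false⇐ (suc n) {g} zero    e = cong (_∧ ⋀ n (g ∘ suc)) e
⋀-false⇐ (suc n) {g} (suc j) e = trans (cong (g zero ∧_) (⋀-false⇐ n j e)) (∧-zeroʳ (g zero))

⋀-false⇔ : ∀ n {g : Fin n → Bool} → ⋀ n g ≡ false ⇔ (∃[ j ] g j ≡ false)
⋀-false⇔ n = mk⇔ (⋀-false⇒ n) λ (j , e) → ⋀-false⇐ n j e

bool-dichotomy : ∀ {a b : Bool} → a ≢ b → ∀ c → c ≡ a ⊎ c ≡ b
bool-dichotomy {a} {b} a≢b c with c Bool.≟ a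
... | yes c≡a = inj₁ c≡a
... | no  c≢a = inj₂ (trans (¬-not c≢a) (sym (¬-not (a≢b ∘ sym))))

≡-or-punchIn : ∀ {n} (j i : Fin (suc n)) → i ≡ j ⊎ ∃[ i′ ] punchIn j i′ ≡ i
≡-or-punchIn j i with j ≟ i
... | yes j≡i = inj₁ (sym j≡i)
... | no  j≢i = inj₂ (punchOut j≢i , punchIn-punchOut j≢i)

-- K i b z: cell i, set to b, rejects the point z; an unset cell (nothing) rejects nothing.
System : ℕ → ℕ → Set₁
System q n = Fin n → Bool → Fin q → Set

Rejected : ∀ {q n} → System q n → (Fin n → Maybe Bool) → Fin q → Set
Rejected K c z = ∃[ i ] ∃[ b ] c i ≡ just b × K i b z

Universal : ∀ {q n} → System q n → Set
Universal {q} K = (f : Fin q → Bool) → ∃[ c ] ∀ z → (f z ≡ false ⇔ Rejected K c z)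

Isolates : ∀ {q n} → System q n → Fin n → Bool → Fin q → Set
Isolates K i b x = K i b x × ∀ z → K i b z → z ≡ x

isolating : ∀ {q n} (K : System q n) → Universal K → ∀ x → ∃[ i ] ∃[ b ] Isolates K i b x
isolating K U x with U (λ z → not (does (z ≟ x)))
... | c , represents with represents x .to (cong not (dec-true (x ≟ x) refl))
...   | i , b , cᵢ , rejects-x = i , b , rejects-x , only-x
  where
  only-x : ∀ z → K i b z → z ≡ x
  only-x z rejects-z with z ≟ x | represents z .from (i , b , cᵢ , rejects-z)
  ... | yes z≡x | _  = z≡x
  ... | no  _   | ()

record Collision {q n} (K : System q n) : Set where
  field
    cell   : Fin n
    x y    : Fin q
    y≢x    : y ≢ x
    bx by  : Bool
    isoX   : Isolates K cell bx x
    isoY   : Isolates K cell by y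

collision : ∀ {q n} (K : System q n) → Universal K → n < q → Collision K
collision K U n<q with pigeonhole n<q (proj₁ ∘ isolating K U)
... | x , y , x<y , same-cell =
  let i , bx , isoX = isolating K U x
      _ , by , isoY = isolating K U y
  in record { cell = i ; x = x ; y = y ; y≢x = <⇒≢ x<y ∘ sym ; bx = bx ; by = by ; isoX = isoX
            ; isoY = subst (λ j → Isolates K j by y) (sym same-cell) isoY }

module Merge {q n} (K : System (suc q) (suc n)) (C : Collision K) where
  open Collision C

  bx≢by : bx ≢ by
  bx≢by bx≡by = y≢x (proj₂ isoX y (subst (λ b → K cell b y) (sym bx≡by) (proj₁ isoY)))

  rejects-x-or-y : ∀ {b z} → K cell b z → z ≡ x ⊎ z ≡ y
  rejects-x-or-y {b} k with bool-dichotomy bx≢by b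
  ... | inj₁ refl = inj₁ (proj₂ isoX _ k)
  ... | inj₂ refl = inj₂ (proj₂ isoY _ k)

  never-rejects-both : ∀ {b} → K cell b x → K cell b y → ⊥
  never-rejects-both {b} kx ky with bool-dichotomy bx≢by b
  ... | inj₁ refl = y≢x (proj₂ isoX y ky)
  ... | inj₂ refl = y≢x (sym (proj₂ isoY x kx))

  x′ : Fin q
  x′ = punchOut y≢x

  collapse : Fin (suc q) → Fin q
  collapse z with y ≟ z
  ... | yes _   = x′
  ... | no  y≢z = punchOut y≢z

  collapse-y : collapse y ≡ x′
  collapse-y with y ≟ y
  ... | yes _   = refl
  ... | no  y≢y = contradiction refl y≢y

  collapse-punchIn : ∀ w → collapse (punchIn y w) ≡ w
  collapse-punchIn w with y ≟ punchIn y w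
  ... | yes y≡ = contradiction (sym y≡) (punchInᵢ≢i y w)
  ... | no  y≢ = trans (punchOut-cong y refl) (punchOut-punchIn y)

  punchIn≡x : ∀ {w} → punchIn y w ≡ x → w ≡ x′
  punchIn≡x {w} e = punchIn-injective y w x′ (trans e (sym (punchIn-punchOut y≢x)))

  -- cell i rejects w when the corresponding old cell rejects a point that collapse sends to w
  merged : System q n
  merged i b w = K (punchIn cell i) b (punchIn y w) ⊎ (w ≡ x′ × K (punchIn cell i) b y)

  merged-universal : Universal K → Universal merged
  merged-universal U f with U (f ∘ collapse)
  ... | c , represents = c ∘ punchIn cell , λ w → mk⇔ (rejected w) (accepted w)
    where
    at : ∀ {z} → f (collapse z) ≡ false → Rejected K c z
    at = represents _ .to

    -- If only the deleted cell rejects the point of w, that point is x; then y is rejected by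
    -- another cell, which in the merged system rejects w.
    rejected : ∀ w → f w ≡ false → Rejected merged (c ∘ punchIn cell) w
    rejected w fw with at (subst (λ v → f v ≡ false) (sym (collapse-punchIn w)) fw)
    ... | i , b , cᵢ , k with ≡-or-punchIn cell i
    ...   | inj₂ (i′ , refl) = i′ , b , cᵢ , inj₁ k
    ...   | inj₁ refl with rejects-x-or-y k
    ...     | inj₂ e = contradiction e (punchInᵢ≢i y w)
    ...     | inj₁ e with at (subst (λ v → f v ≡ false) (trans (punchIn≡x e) (sym collapse-y)) fw)
    ...       | i₂ , b₂ , cᵢ₂ , k₂ with ≡-or-punchIn cell i₂
    ...         | inj₂ (i₂′ , refl) = i₂′ , b₂ , cᵢ₂ , inj₂ (punchIn≡x e , k₂)
    ...         | inj₁ refl = contradiction (subst (λ v → K cell v y) (just-injective (trans (sym cᵢ₂) cᵢ)) k₂)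
                                            (never-rejects-both (subst (K cell b) e k))

    accepted : ∀ w → Rejected merged (c ∘ punchIn cell) w → f w ≡ false
    accepted w (i , b , cᵢ , inj₁ k) =
      subst (λ v → f v ≡ false) (collapse-punchIn w) (represents _ .from (punchIn cell i , b , cᵢ , k))
    accepted w (i , b , cᵢ , inj₂ (w≡x′ , k)) =
      subst (λ v → f v ≡ false) (trans collapse-y (sym w≡x′)) (represents y .from (punchIn cell i , b , cᵢ , k))

universal⇒≤ : ∀ {q n} (K : System q n) → Universal K → q ≤ n
universal⇒≤ {zero}          K U = z≤n
universal⇒≤ {suc q} {zero}  K U with () ← proj₁ (isolating K U zero)
universal⇒≤ {suc q} {suc n} K U = ≮⇒≥ λ n<q →
  let C = collision K U n<q
  in <⇒≱ n<q (s≤s (universal⇒≤ (Merge.merged K C) (Merge.merged-universal K C U)))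

bit : Bool → B•
bit false = b0
bit true  = b1

-- setting bullet is junk: ϑ never takes the value • when β ≠ •.
setting : B• → Maybe Bool
setting b0     = just false
setting b1     = just true
setting star   = nothing
setting bullet = nothing

T-star : ∀ u → T u star ≡ true
T-star b0     = refl
T-star b1     = refl
T-star star   = refl
T-star bullet = refl

T≡false⇔setting : ∀ u {v} → v ≢ bullet → T u v ≡ false ⇔ (∃[ b ] setting v ≡ just b × T u (bit b) ≡ false)
T≡false⇔setting u {b0}     _ = mk⇔ (λ e → false , refl , e) λ { (false , refl , e) → e }
T≡false⇔setting u {b1}     _ = mk⇔ (λ e → true , refl , e) λ { (true , refl , e) → e }
T≡false⇔setting u {star}   _ = mk⇔ (λ e → contradiction (trans (sym (T-star u)) e) λ ()) λ { (_ , () , _) }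
T≡false⇔setting u {bullet} v≢• = contradiction refl v≢•

Alph-≢bullet : ∀ {β} → β ≢ dot → (v : Alph β) → proj₁ v ≢ bullet
Alph-≢bullet {circ} _     (bullet , ()) refl
Alph-≢bullet {ast}  _     (bullet , ()) refl
Alph-≢bullet {dot}  β≢dot _             _    = β≢dot refl

rejection-system : ∀ {α q n} → (Fin q → Fin n → Alph α) → System q n
rejection-system u j b x = T (proj₁ (u x j)) (bit b) ≡ false

implementable⇒universal : ∀ {α β q n} → β ≢ dot → ((u , _) : Implementable α β q n (Allℱ q)) →
                          Universal (rejection-system u)
implementable⇒universal {n = n} β≢dot (u , ϑ , implements) f = c , λ z → mk⇔ (rejected z) (accepted z)
  where
  c : Fin n → Maybe Bool
  c j = setting (proj₁ (ϑ f tt j))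

  cell⇔ : ∀ z j → T (proj₁ (u z j)) (proj₁ (ϑ f tt j)) ≡ false ⇔ (∃[ b ] c j ≡ just b × rejection-system u j b z)
  cell⇔ z j = T≡false⇔setting (proj₁ (u z j)) (Alph-≢bullet β≢dot (ϑ f tt j))

  rejected : ∀ z → f z ≡ false → Rejected (rejection-system u) c z
  rejected z fz = let j , e = ⋀-false⇔ n .to (trans (sym (implements f tt z)) fz)
                  in j , cell⇔ z j .to e

  accepted : ∀ z → Rejected (rejection-system u) c z → f z ≡ false
  accepted z (j , r) = trans (implements f tt z) (⋀-false⇔ n .from (j , cell⇔ z j .from r))

implementable⇒≤ : ∀ {α β q n} → β ≢ dot → Implementable α β q n (Allℱ q) → q ≤ n
implementable⇒≤ β≢dot impl = universal⇒≤ _ (implementable⇒universal β≢dot impl)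

-- Outside the image of e the value is arbitrary.
extend : ∀ {q n} → (Fin q → Fin n) → (Fin q → Bool) → Fin n → Bool
extend e f j with any? (λ x → e x ≟ j)
... | yes (x , _) = f x
... | no  _       = true

extend-extends : ∀ {q n} {e : Fin q → Fin n} → Injective _≡_ _≡_ e → ∀ f x → extend e f (e x) ≡ f x
extend-extends {e = e} e-injective f x with any? (λ x′ → e x′ ≟ e x)
... | yes (x′ , ex′≡ex) = cong f (e-injective ex′≡ex)
... | no  ∄x           = contradiction (x , refl) ∄x

diagonal-implementation : ∀ {α β q n} (on off : Alph α) (enc : Bool → Alph β) →
  (∀ b → T (proj₁ on) (proj₁ (enc b)) ≡ b) → (∀ b → T (proj₁ off) (proj₁ (enc b)) ≡ true) →
  q ≤ n → Implementable α β q n (Allℱ q)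
diagonal-implementation {α} {β} {q} {n} on off enc T-on T-off q≤n = u , ϑ , implements
  where
  e : Fin q → Fin n
  e x = inject≤ x q≤n

  u : Fin q → Fin n → Alph α
  u x j = if does (e x ≟ j) then on else off

  ϑ : (f : ℱ q) → Allℱ q f → Fin n → Alph β
  ϑ f _ j = enc (extend e f j)

  T-uϑ : ℱ q → Fin q → Fin n → Bool
  T-uϑ f x j = T (proj₁ (u x j)) (proj₁ (ϑ f tt j))

  off-diagonal : ∀ f x j → j ≢ e x → T-uϑ f x j ≡ true
  off-diagonal f x j j≢ex rewrite dec-false (e x ≟ j) (j≢ex ∘ sym) = T-off _

  on-diagonal : ∀ f x → T-uϑ f x (e x) ≡ f x
  on-diagonal f x rewrite dec-true (e x ≟ e x) refl =
    trans (T-on _) (extend-extends (inject≤-injective q≤n q≤n _ _) f x)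

  implements : (f : ℱ q) (φ : Allℱ q f) (x : Fin q) → f x ≡ ⋀ n (T-uϑ f x)
  implements f _ x = sym (trans (⋀-single n (e x) (off-diagonal f x)) (on-diagonal f x))

inAlph-bit : ∀ α b → InAlph α (bit b)
inAlph-bit circ false = tt
inAlph-bit circ true  = tt
inAlph-bit ast  false = tt
inAlph-bit ast  true  = tt
inAlph-bit dot  false = tt
inAlph-bit dot  true  = tt

bitₐ : ∀ α → Bool → Alph α
bitₐ α b = bit b , inAlph-bit α b

wildcard-if : Bool → Alph ast
wildcard-if true  = star , tt
wildcard-if false = b0 , tt

implementable-*∘ : ∀ {q n} → q ≤ n → Implementable ast circ q n (Allℱ q)
implementable-*∘ = diagonal-implementation (bitₐ ast true) (star , tt) (bitₐ circ)
  (λ { false → refl ; true → refl }) (λ _ → refl)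

implementable-α* : ∀ α {q n} → q ≤ n → Implementable α ast q n (Allℱ q)
implementable-α* α = diagonal-implementation (bitₐ α true) (bitₐ α false) wildcard-if
  (λ { false → refl ; true → refl }) (λ { false → refl ; true → refl })

proposition16 : (q n : ℕ) → 2 ≤ q → 1 ≤ n → (α β : Sym) →
    ((α ≡ ast × β ≡ circ) ⊎ (α ≡ circ × β ≡ ast) ⊎ (α ≡ ast × β ≡ ast) ⊎ (α ≡ dot × β ≡ ast)) →
    (Implementable α β q n (Allℱ q) ⇔ q ≤ n)
proposition16 q n _ _ .ast  .circ (inj₁ (refl , refl)) =
  mk⇔ (implementable⇒≤ λ ()) implementable-*∘
proposition16 q n _ _ .circ .ast  (inj₂ (inj₁ (refl , refl))) =
  mk⇔ (implementable⇒≤ λ ()) (implementable-α* circ)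
proposition16 q n _ _ .ast  .ast  (inj₂ (inj₂ (inj₁ (refl , refl)))) =
  mk⇔ (implementable⇒≤ λ ()) (implementable-α* ast)
proposition16 q n _ _ .dot  .ast  (inj₂ (inj₂ (inj₂ (refl , refl)))) =
  mk⇔ (implementable⇒≤ {dot} λ ()) (implementable-α* dot)
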